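{- Let $R$ be a finite commutative ring with identity, written as a direct sum of local rings $R = R_1\oplus\cdots\oplus R_n$, where $R_i$ has unique maximal ideal $M_i$, $m_i=|M_i|$ and $q_i=|R_i/M_i|$. Assume $q_i>2$ for each $i$. For an integer $k\ge 2$ and a unit $u=(u_1,\ldots,u_n)\in R^*$, let $\theta_{k,R}(u)$ be the number of $k$-tuples $(x_1,\ldots,x_k)\in (R^{**})^k$ with $x_1x_2\cdots x_k=u$. Then $$\theta_{k,R}(u)=\prod_{i=1}^n m_i^{k-1}(q_i-1)^{ -1}\sigma_{k,R_i}(u_i),$$ where $$\sigma_{k,R_i}(u_i)=\begin{cases}(q_i-2)^k+(-1)^k(q_i-2) & \text{if } u_i\in 1+M_i,\\ (q_i-2)^k+(-1)^{k+1} & \text{if } u_i\notin 1+M_i.\end{cases}$$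
   Context: A unit $u$ of a commutative ring $R$ with identity is called exceptional if $1-u$ is also a unit; $R^{**}$ denotes the set of exceptional units and $R^*$ the unit group. Every finite commutative ring with identity is uniquely a direct sum of finite local rings. -}

module Defs where

open import Level using (Level; _⊔_)
open import Algebra.Bundles using (CommutativeRing)
open import Algebra.Structures using (IsCommutativeRing)
open import Data.Nat as ℕ using (ℕ; zero; _<_)
open import Data.Fin using (Fin)
import Data.Fin as Fin
open import Data.Integer as ℤ using (ℤ)
open import Data.Product using (Σ; ∃; _×_; _,_; proj₁; proj₂)
open import Relation.Binary.PropositionalEquality using (_≡_)
open import Relation.Nullary using (¬_)
open import Relation.Unary using (Pred; _⊆_)
open import Data.Sum using (_⊎_)

private
  variable
    c ℓ p r : Level

-- Cardinality of a subset of a type modulo an equivalence relation.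

record HasSize {a} {A : Set a} (_~_ : A → A → Set r) (P : Pred A p) (N : ℕ)
       : Set (a ⊔ r ⊔ p) where
  field
    elt      : Fin N → A
    elt-P    : ∀ i → P (elt i)
    elt-inj  : ∀ i j → elt i ~ elt j → i ≡ j
    elt-surj : ∀ x → P x → ∃ λ i → elt i ~ x

Every : ∀ {a} {A : Set a} → Pred A Level.zero
Every _ = Level.Lift Level.zero (Data.Unit.⊤)
  where import Data.Unit

module _ (R : CommutativeRing c ℓ) where
  open CommutativeRing R

  Finite : Set (c ⊔ ℓ)
  Finite = ∃ λ N → HasSize _≈_ Every N

  IsUnit : Carrier → Set (c ⊔ ℓ)
  IsUnit x = ∃ λ y → x * y ≈ 1#

  IsExceptional : Carrier → Set (c ⊔ ℓ)
  IsExceptional x = IsUnit x × IsUnit (1# - x)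

  record IsIdeal (I : Pred Carrier (c ⊔ ℓ)) : Set (c ⊔ ℓ) where
    field
      resp  : ∀ {x y} → x ≈ y → I x → I y
      zero∈ : I 0#
      +∈    : ∀ {x y} → I x → I y → I (x + y)
      *∈    : ∀ r {x} → I x → I (r * x)

  record IsMaximalIdeal (I : Pred Carrier (c ⊔ ℓ)) : Set (Level.suc (c ⊔ ℓ)) where
    field
      isIdeal : IsIdeal I
      proper  : ¬ I 1#
      maximal : ∀ (J : Pred Carrier (c ⊔ ℓ)) → IsIdeal J → I ⊆ J → (J ⊆ I) ⊎ J 1#

  record IsUniqueMaximalIdeal (M : Pred Carrier (c ⊔ ℓ)) : Set (Level.suc (c ⊔ ℓ)) where
    field
      isMaximal : IsMaximalIdeal M
      unique    : ∀ (J : Pred Carrier (c ⊔ ℓ)) → IsMaximalIdeal J → (J ⊆ M) × (M ⊆ J)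

  -- congruence modulo an ideal: x ~ y iff x - y ∈ I  (elements of R / I)
  _≡[mod_]_ : Carrier → Pred Carrier (c ⊔ ℓ) → Carrier → Set (c ⊔ ℓ)
  x ≡[mod I ] y = I (x - y)

  prodTuple : (k : ℕ) → (Fin k → Carrier) → Carrier
  prodTuple zero    x = 1#
  prodTuple (ℕ.suc k) x = x Fin.zero * prodTuple k (λ i → x (Fin.suc i))

module _ (n : ℕ) (R : Fin n → CommutativeRing c ℓ) where
  private
    module R i = CommutativeRing (R i)

  ⨁ : CommutativeRing c ℓ
  ⨁ = record
    { Carrier = (i : Fin n) → R.Carrier i
    ; _≈_ = λ x y → ∀ i → R._≈_ i (x i) (y i)
    ; _+_ = λ x y i → R._+_ i (x i) (y i)
    ; _*_ = λ x y i → R._*_ i (x i) (y i)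
    ; -_  = λ x i → R.-_ i (x i)
    ; 0#  = λ i → R.0# i
    ; 1#  = λ i → R.1# i
    ; isCommutativeRing = record
      { isRing = record
        { +-isAbelianGroup = record
          { isGroup = record
            { isMonoid = record
              { isSemigroup = record
                { isMagma = record
                  { isEquivalence = record
                    { refl  = λ i → R.refl i
                    ; sym   = λ p i → R.sym i (p i)
                    ; trans = λ p q i → R.trans i (p i) (q i) }
                  ; ∙-cong = λ p q i → R.+-cong i (p i) (q i) }
                ; assoc = λ x y z i → R.+-assoc i (x i) (y i) (z i) }
              ; identity = (λ x i → R.+-identityˡ i (x i)) , (λ x i → R.+-identityʳ i (x i)) }
            ; inverse = (λ x i → R.-‿inverseˡ i (x i)) , (λ x i → R.-‿inverseʳ i (x i))
            ; ⁻¹-cong = λ p i → R.-‿cong i (p i) }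
          ; comm = λ x y i → R.+-comm i (x i) (y i) }
        ; *-cong = λ p q i → R.*-cong i (p i) (q i)
        ; *-assoc = λ x y z i → R.*-assoc i (x i) (y i) (z i)
        ; *-identity = (λ x i → R.*-identityˡ i (x i)) , (λ x i → R.*-identityʳ i (x i))
        ; distrib = (λ x y z i → R.distribˡ i (x i) (y i) (z i)) , (λ x y z i → R.distribʳ i (x i) (y i) (z i)) }
      ; *-comm = λ x y i → R.*-comm i (x i) (y i) } }

∏ℤ : (n : ℕ) → (Fin n → ℤ) → ℤ
∏ℤ zero      f = ℤ.+ 1
∏ℤ (ℕ.suc n) f = f Fin.zero ℤ.* ∏ℤ n (λ i → f (Fin.suc i))

SigmaSpec : ∀ {a} (q k : ℕ) (inM : Set a) (s : ℤ) → Set a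
SigmaSpec q k inM s =
    (inM → s ≡ (ℤ.+ (q ℕ.∸ 2)) ℤ.^ k ℤ.+ (ℤ.- ℤ.1ℤ) ℤ.^ k ℤ.* ℤ.+ (q ℕ.∸ 2))
  × (¬ inM → s ≡ (ℤ.+ (q ℕ.∸ 2)) ℤ.^ k ℤ.+ (ℤ.- ℤ.1ℤ) ℤ.^ (ℕ.suc k))

module Submission where

-- Structure of the proof.
-- * Counting: a toolkit for the cardinalities 'HasSize' (transport along
--   bijections, uniqueness, sums, products, decidable splittings).
-- * Finite local rings (R, M): maximality of M decides every proposition;
--   finiteness makes every proper ideal lie in M, so x is a unit iff x ∉ M
--   and x is exceptional iff x ∉ M and x ∉ 1 + M.  Hence |R| = q m,
--   |1 + M| = m and R has T = (q - 2) m exceptional units.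
-- * Writing c_j(v) for the number of exceptional j-tuples with product v,
--   splitting the T^(j+1) exceptional (j+1)-tuples according to whether
--   their product is ≡ v mod M gives c_{j+2}(v) + m c_{j+1}(v) = T^(j+1);
--   with c₁(v) = [v ∉ 1 + M] this recurrence solves to the local formula.
-- * Tuples over ⨁ Rᵢ are families of tuples over the Rᵢ, so θ = ∏ θᵢ, and
--   the theorem is the product of the local formulas.

open import Defs
open import Level using (Level; _⊔_; Lift; lift; lower)
open import Algebra.Bundles using (CommutativeRing)
open import Data.Nat as ℕ using (ℕ; zero; suc; _<_; _≤_; _∸_; z≤n; s≤s)
import Data.Nat.Properties as ℕP
open import Data.Fin as F using (Fin; splitAt; join; _↑ˡ_; _↑ʳ_; remQuot; combine)
import Data.Fin.Properties as FP
open import Data.Integer as ℤ using (ℤ; +_; -[1+_]; _⊖_; _◃_; sign; ∣_∣)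
import Data.Integer.Properties as ℤP
open import Data.Sign as Sign using (Sign)
open import Data.Maybe using (Maybe; nothing; just)
open import Data.Product using (∃; _×_; _,_; proj₁; proj₂)
open import Data.Sum using (_⊎_; inj₁; inj₂)
open import Data.Unit using (tt)
open import Data.Vec.Functional using (_∷_; tail)
open import Data.Empty using (⊥; ⊥-elim)
open import Relation.Binary.PropositionalEquality as P using (_≡_)
open import Relation.Nullary using (¬_; Dec; yes; no)
open import Relation.Nullary.Decidable using (¬?)
open import Relation.Unary using (Pred; _⊆_)

-- The canonical map ι : ℤ → R into any commutative ring is a ring morphism;
-- it lets the library's ring solver prove identities with integer
-- coefficients (such as cancellations x - x ≈ 0) in R.
module IntegerCoefficientSolver {c ℓ} (R : CommutativeRing c ℓ) where
  open CommutativeRing R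
  open import Algebra.Properties.Ring ring using (-0#≈0#; -‿+-comm; -1*x≈-x; -‿involutive)
  open import Algebra.Properties.Monoid.Mult.TCOptimised +-monoid
    using (×-homo-+; 1+×) renaming (_×_ to _·_)
  open import Algebra.Properties.Semiring.Mult.TCOptimised semiring using (×1-homo-*)
  open import Algebra.Solver.Ring.AlmostCommutativeRing
    using (AlmostCommutativeRing; fromCommutativeRing; _-Raw-AlmostCommutative⟶_)
  open import Relation.Binary.Reasoning.Setoid setoid

  nat : ℕ → Carrier
  nat n = n · 1#

  ι : ℤ → Carrier
  ι (+ n)    = nat n
  ι -[1+ n ] = - nat (suc n)

  ι-⊖ : ∀ m n → ι (m ⊖ n) ≈ nat m - nat n
  ι-⊖ m zero = sym (trans (+-congˡ -0#≈0#) (+-identityʳ _))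
  ι-⊖ zero (suc n) = sym (+-identityˡ _)
  ι-⊖ (suc m) (suc n) = begin
    ι (suc m ⊖ suc n)           ≡⟨ P.cong ι (ℤP.[1+m]⊖[1+n]≡m⊖n m n) ⟩
    ι (m ⊖ n)                   ≈⟨ ι-⊖ m n ⟩
    nat m - nat n               ≈⟨ sym (shift (nat m) (nat n)) ⟩
    (1# + nat m) - (1# + nat n) ≈⟨ sym (+-cong (1+× m 1#) (-‿cong (1+× n 1#))) ⟩
    nat (suc m) - nat (suc n)   ∎
    where
    shift : ∀ a b → (1# + a) - (1# + b) ≈ a - b
    shift a b = begin
      (1# + a) + - (1# + b)   ≈⟨ +-congˡ (sym (-‿+-comm 1# b)) ⟩
      (1# + a) + (- 1# + - b) ≈⟨ +-assoc 1# a _ ⟩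
      1# + (a + (- 1# + - b)) ≈⟨ +-congˡ (sym (+-assoc a _ _)) ⟩
      1# + ((a + - 1#) + - b) ≈⟨ +-congˡ (+-congʳ (+-comm a _)) ⟩
      1# + ((- 1# + a) + - b) ≈⟨ +-congˡ (+-assoc _ a _) ⟩
      1# + (- 1# + (a + - b)) ≈⟨ sym (+-assoc 1# _ _) ⟩
      (1# + - 1#) + (a + - b) ≈⟨ +-congʳ (-‿inverseʳ 1#) ⟩
      0# + (a + - b)          ≈⟨ +-identityˡ _ ⟩
      a - b                   ∎

  signed : Sign → Carrier
  signed Sign.+ = 1#
  signed Sign.- = - 1#

  ι-◃ : ∀ s n → ι (s ◃ n) ≈ signed s * nat n
  ι-◃ Sign.- zero    = sym (zeroʳ _)
  ι-◃ Sign.+ zero    = sym (zeroʳ _)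
  ι-◃ Sign.+ (suc n) = sym (*-identityˡ _)
  ι-◃ Sign.- (suc n) = sym (-1*x≈-x _)

  ι-signAbs : ∀ i → ι i ≈ signed (sign i) * nat ∣ i ∣
  ι-signAbs (+ n)    = sym (*-identityˡ _)
  ι-signAbs -[1+ n ] = sym (-1*x≈-x _)

  signed-* : ∀ s t → signed (s Sign.* t) ≈ signed s * signed t
  signed-* Sign.+ t      = sym (*-identityˡ _)
  signed-* Sign.- Sign.+ = sym (*-identityʳ _)
  signed-* Sign.- Sign.- = sym (trans (-1*x≈-x _) (-‿involutive 1#))

  ι-+ : ∀ i j → ι (i ℤ.+ j) ≈ ι i + ι j
  ι-+ (+ m)    (+ n)    = ×-homo-+ 1# m n
  ι-+ (+ m)    -[1+ n ] = ι-⊖ m (suc n)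
  ι-+ -[1+ m ] (+ n)    = trans (ι-⊖ n (suc m)) (+-comm _ _)
  ι-+ -[1+ m ] -[1+ n ] = begin
    - nat (suc (suc (m ℕ.+ n)))   ≡⟨ P.cong (λ k → - nat (suc k)) (P.sym (ℕP.+-suc m n)) ⟩
    - nat (suc m ℕ.+ suc n)       ≈⟨ -‿cong (×-homo-+ 1# (suc m) (suc n)) ⟩
    - (nat (suc m) + nat (suc n)) ≈⟨ sym (-‿+-comm _ _) ⟩
    - nat (suc m) + - nat (suc n) ∎

  ι-* : ∀ i j → ι (i ℤ.* j) ≈ ι i * ι j
  ι-* i j = begin
    ι (sign i Sign.* sign j ◃ ∣ i ∣ ℕ.* ∣ j ∣)
      ≈⟨ ι-◃ (sign i Sign.* sign j) (∣ i ∣ ℕ.* ∣ j ∣) ⟩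
    signed (sign i Sign.* sign j) * nat (∣ i ∣ ℕ.* ∣ j ∣)
      ≈⟨ *-cong (signed-* (sign i) (sign j)) (×1-homo-* ∣ i ∣ ∣ j ∣) ⟩
    (a * b) * (x * y) ≈⟨ *-assoc a b _ ⟩
    a * (b * (x * y)) ≈⟨ *-congˡ (sym (*-assoc b x y)) ⟩
    a * ((b * x) * y) ≈⟨ *-congˡ (*-congʳ (*-comm b x)) ⟩
    a * ((x * b) * y) ≈⟨ *-congˡ (*-assoc x b y) ⟩
    a * (x * (b * y)) ≈⟨ sym (*-assoc a x _) ⟩
    (a * x) * (b * y) ≈⟨ *-cong (sym (ι-signAbs i)) (sym (ι-signAbs j)) ⟩
    ι i * ι j         ∎
    where
    a = signed (sign i); b = signed (sign j); x = nat ∣ i ∣; y = nat ∣ j ∣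

  ι-neg : ∀ i → ι (ℤ.- i) ≈ - ι i
  ι-neg (+ zero)  = sym -0#≈0#
  ι-neg (+ suc n) = refl
  ι-neg -[1+ n ]  = sym (-‿involutive _)

  almostCommutativeRing : AlmostCommutativeRing c ℓ
  almostCommutativeRing = fromCommutativeRing R

  ι-morphism : ℤ.+-*-rawRing -Raw-AlmostCommutative⟶ almostCommutativeRing
  ι-morphism = record
    { ⟦_⟧ = ι ; +-homo = ι-+ ; *-homo = ι-* ; -‿homo = ι-neg
    ; 0-homo = refl ; 1-homo = refl }

  ι-equal? : ∀ i j → Maybe (ι i ≈ ι j)
  ι-equal? i j with i ℤ.≟ j
  ... | yes P.refl = just refl
  ... | no _     = nothing

  open import Algebra.Solver.Ring ℤ.+-*-rawRing almostCommutativeRing ι-morphism ι-equal? public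

module Counting where
  open HasSize

  module _ {a b r s p q : Level} {A : Set a} {B : Set b}
           {_~_ : A → A → Set r} {_≈_ : B → B → Set s}
           {P : Pred A p} {Q : Pred B q} where
    map-size : ∀ {n} (f : A → B)
      (≈-trans : ∀ {x y z} → x ≈ y → y ≈ z → x ≈ z)
      (f-cong  : ∀ {x y} → P x → x ~ y → f x ≈ f y)
      (f-pred  : ∀ {x} → P x → Q (f x))
      (f-inj   : ∀ {x y} → P x → P y → f x ≈ f y → x ~ y)
      (f-surj  : ∀ {y} → Q y → ∃ λ x → P x × f x ≈ y)
      → HasSize _~_ P n → HasSize _≈_ Q n
    map-size f ≈-trans f-cong f-pred f-inj f-surj h = record
      { elt      = λ i → f (elt h i)
      ; elt-P    = λ i → f-pred (elt-P h i)
      ; elt-inj  = λ i j e → elt-inj h i j (f-inj (elt-P h i) (elt-P h j) e)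
      ; elt-surj = λ y qy →
          let (x , px , fx≈y) = f-surj qy
              (i , eᵢ≈x)      = elt-surj h x px
          in i , ≈-trans (f-cong (elt-P h i) eᵢ≈x) fx≈y }

  -- The size of a set is unique (by the pigeonhole principle).
  module _ {a r p : Level} {A : Set a} {_~_ : A → A → Set r} {P : Pred A p}
           (~-sym : ∀ {x y} → x ~ y → y ~ x)
           (~-trans : ∀ {x y z} → x ~ y → y ~ z → x ~ z) where
    private
      size-≤ : ∀ {m n} → HasSize _~_ P m → HasSize _~_ P n → m ℕ.≤ n
      size-≤ {m} {n} h k with m ℕ.≤? n
      ... | yes m≤n = m≤n
      ... | no m≰n =
        let (i , j , i<j , gi≡gj) = FP.pigeonhole (ℕP.≰⇒> m≰n) g
        in ⊥-elim (FP.<⇒≢ i<j (g-injective i j gi≡gj))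
        where
        g : Fin m → Fin n
        g i = proj₁ (elt-surj k (elt h i) (elt-P h i))
        g-injective : ∀ i j → g i ≡ g j → i ≡ j
        g-injective i j gi≡gj = elt-inj h i j
          (~-trans (~-sym (proj₂ (elt-surj k (elt h i) (elt-P h i))))
            (P.subst (λ t → elt k t ~ elt h j) (P.sym gi≡gj)
              (proj₂ (elt-surj k (elt h j) (elt-P h j)))))

    size-unique : ∀ {m n} → HasSize _~_ P m → HasSize _~_ P n → m ≡ n
    size-unique h k = ℕP.≤-antisym (size-≤ h k) (size-≤ k h)

  module _ {a r p q : Level} {A : Set a} {_~_ : A → A → Set r} {P : Pred A p} {Q : Pred A q}
           (~-sym : ∀ {x y} → x ~ y → y ~ x)
           (P-resp : ∀ {x y} → x ~ y → P x → P y)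
           (disjoint : ∀ {x} → P x → Q x → ⊥) where
    size-⊎ : ∀ {m n} → HasSize _~_ P m → HasSize _~_ Q n → HasSize _~_ (λ x → P x ⊎ Q x) (m ℕ.+ n)
    size-⊎ {m} {n} h k = record { elt = el ; elt-P = el-P ; elt-inj = el-inj ; elt-surj = el-surj }
      where
      choose : Fin m ⊎ Fin n → A
      choose (inj₁ i) = elt h i
      choose (inj₂ j) = elt k j
      choose-P : ∀ s → P (choose s) ⊎ Q (choose s)
      choose-P (inj₁ i) = inj₁ (elt-P h i)
      choose-P (inj₂ j) = inj₂ (elt-P k j)
      choose-inj : ∀ s t → choose s ~ choose t → s ≡ t
      choose-inj (inj₁ i) (inj₁ j) e = P.cong inj₁ (elt-inj h i j e)
      choose-inj (inj₂ i) (inj₂ j) e = P.cong inj₂ (elt-inj k i j e)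
      choose-inj (inj₁ i) (inj₂ j) e = ⊥-elim (disjoint (P-resp e (elt-P h i)) (elt-P k j))
      choose-inj (inj₂ i) (inj₁ j) e = ⊥-elim (disjoint (P-resp (~-sym e) (elt-P h j)) (elt-P k i))
      el : Fin (m ℕ.+ n) → A
      el i = choose (splitAt m i)
      el-P : ∀ i → P (el i) ⊎ Q (el i)
      el-P i = choose-P (splitAt m i)
      el-inj : ∀ i j → el i ~ el j → i ≡ j
      el-inj i j e = P.trans (P.sym (FP.join-splitAt m n i))
        (P.trans (P.cong (join m n) (choose-inj (splitAt m i) (splitAt m j) e)) (FP.join-splitAt m n j))
      el-surj : ∀ x → P x ⊎ Q x → ∃ λ i → el i ~ x
      el-surj x (inj₁ px) = let (i , e) = elt-surj h x px in
        i ↑ˡ n , P.subst (λ t → choose t ~ x) (P.sym (FP.splitAt-↑ˡ m i n)) e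
      el-surj x (inj₂ qx) = let (i , e) = elt-surj k x qx in
        m ↑ʳ i , P.subst (λ t → choose t ~ x) (P.sym (FP.splitAt-↑ʳ m n i)) e

  module _ {a b r s p q : Level} {A : Set a} {B : Set b}
           {_~_ : A → A → Set r} {_≈_ : B → B → Set s}
           {P : Pred A p} {Q : Pred B q} where
    size-× : ∀ {m n} → HasSize _~_ P m → HasSize _≈_ Q n →
      HasSize (λ u v → proj₁ u ~ proj₁ v × proj₂ u ≈ proj₂ v) (λ u → P (proj₁ u) × Q (proj₂ u)) (m ℕ.* n)
    size-× {m} {n} h k = record { elt = el ; elt-P = el-P ; elt-inj = el-inj ; elt-surj = el-surj }
      where
      el : Fin (m ℕ.* n) → A × B
      el t = let (i , j) = remQuot {m} n t in elt h i , elt k j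
      el-P : ∀ t → P (proj₁ (el t)) × Q (proj₂ (el t))
      el-P t = elt-P h (proj₁ (remQuot {m} n t)) , elt-P k (proj₂ (remQuot {m} n t))
      el-inj : ∀ t u → proj₁ (el t) ~ proj₁ (el u) × proj₂ (el t) ≈ proj₂ (el u) → t ≡ u
      el-inj t u (e₁ , e₂) =
        let (i , j) = remQuot {m} n t ; (i′ , j′) = remQuot {m} n u in
        P.trans (P.sym (FP.combine-remQuot {m} n t))
          (P.trans (P.cong₂ combine (elt-inj h i i′ e₁) (elt-inj k j j′ e₂)) (FP.combine-remQuot {m} n u))
      el-surj : ∀ x → P (proj₁ x) × Q (proj₂ x) → ∃ λ t → proj₁ (el t) ~ proj₁ x × proj₂ (el t) ≈ proj₂ x
      el-surj (x , y) (px , qy) =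
        let (i , eᵢ) = elt-surj h x px
            (j , eⱼ) = elt-surj k y qy
        in combine i j , P.subst (λ w → elt h (proj₁ w) ~ x × elt k (proj₂ w) ≈ y)
                           (P.sym (FP.remQuot-combine i j)) (eᵢ , eⱼ)

  size-Fin : ∀ {d} (n : ℕ) (D : Fin n → Set d) → (∀ i → Dec (D i)) → ∃ λ m → HasSize _≡_ D m
  size-Fin zero D D? = 0 , record { elt = λ () ; elt-P = λ () ; elt-inj = λ () ; elt-surj = λ () }
  size-Fin (suc n) D D? with size-Fin n (λ i → D (F.suc i)) (λ i → D? (F.suc i)) | D? F.zero
  ... | m , h | yes d₀ = suc m , record { elt = el ; elt-P = el-P ; elt-inj = el-inj ; elt-surj = el-surj }
    where
    el : Fin (suc m) → Fin (suc n)
    el F.zero    = F.zero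
    el (F.suc i) = F.suc (elt h i)
    el-P : ∀ i → D (el i)
    el-P F.zero    = d₀
    el-P (F.suc i) = elt-P h i
    el-inj : ∀ i j → el i ≡ el j → i ≡ j
    el-inj F.zero    F.zero    _  = P.refl
    el-inj (F.suc i) (F.suc j) e  = P.cong F.suc (elt-inj h i j (FP.suc-injective e))
    el-inj F.zero    (F.suc j) ()
    el-inj (F.suc i) F.zero    ()
    el-surj : ∀ x → D x → ∃ λ i → el i ≡ x
    el-surj F.zero    _  = F.zero , P.refl
    el-surj (F.suc x) dx = let (i , e) = elt-surj h x dx in F.suc i , P.cong F.suc e
  ... | m , h | no ¬d₀ = m , record
    { elt      = λ i → F.suc (elt h i)
    ; elt-P    = elt-P h
    ; elt-inj  = λ i j e → elt-inj h i j (FP.suc-injective e)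
    ; elt-surj = el-surj }
    where
    el-surj : ∀ x → D x → ∃ λ i → F.suc (elt h i) ≡ x
    el-surj F.zero    d  = ⊥-elim (¬d₀ d)
    el-surj (F.suc x) dx = let (i , e) = elt-surj h x dx in i , P.cong F.suc e

  module _ {a r p q : Level} {A : Set a} {_~_ : A → A → Set r} {P : Pred A p}
           (~-refl : ∀ {x} → x ~ x) (~-sym : ∀ {x y} → x ~ y → y ~ x)
           (~-trans : ∀ {x y z} → x ~ y → y ~ z → x ~ z)
           (P-resp : ∀ {x y} → x ~ y → P x → P y) where
    size-restrict : ∀ {n} {Q : Pred A q} → (∀ {x y} → x ~ y → Q x → Q y) → (∀ x → Dec (Q x)) →
      HasSize _~_ P n → ∃ λ m → HasSize _~_ (λ x → P x × Q x) m
    size-restrict {n} {Q} Q-resp Q? h =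
      let (m , k) = size-Fin n (λ i → Q (elt h i)) (λ i → Q? (elt h i))
      in m , map-size (elt h) ~-trans (λ { _ P.refl → ~-refl })
           (λ {i} qᵢ → elt-P h i , qᵢ)
           (λ {i} {j} _ _ e → elt-inj h i j e)
           (λ {x} (px , qx) → let (i , e) = elt-surj h x px in i , Q-resp (~-sym e) qx , e) k

    size-split : ∀ {n} {Q : Pred A q} → (∀ {x y} → x ~ y → Q x → Q y) → (∀ x → Dec (Q x)) → HasSize _~_ P n →
      ∃ λ m₁ → ∃ λ m₂ → HasSize _~_ (λ x → P x × Q x) m₁ × HasSize _~_ (λ x → P x × ¬ Q x) m₂
                        × m₁ ℕ.+ m₂ ≡ n
    size-split {n} {Q} Q-resp Q? h =
      let (m₁ , h₁) = size-restrict Q-resp Q? h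
          (m₂ , h₂) = size-restrict (λ e ¬qx qy → ¬qx (Q-resp (~-sym e) qy)) (λ x → ¬? (Q? x)) h
          h₁₊₂ = size-⊎ ~-sym (λ e (px , qx) → P-resp e px , Q-resp e qx) (λ (_ , qx) (_ , ¬qx) → ¬qx qx) h₁ h₂
          h′ = map-size (λ x → x) ~-trans (λ _ e → e) (λ { (inj₁ (px , _)) → px ; (inj₂ (px , _)) → px })
                 (λ _ _ e → e) (λ {y} py → y , cases y py , ~-refl) h₁₊₂
      in m₁ , m₂ , h₁ , h₂ , size-unique ~-sym ~-trans h′ h
      where
      cases : ∀ y → P y → (P y × Q y) ⊎ (P y × ¬ Q y)
      cases y py with Q? y
      ... | yes qy = inj₁ (py , qy)
      ... | no ¬qy = inj₂ (py , ¬qy)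

  ∏ℕ : (n : ℕ) → (Fin n → ℕ) → ℕ
  ∏ℕ zero    f = 1
  ∏ℕ (suc n) f = f F.zero ℕ.* ∏ℕ n (λ i → f (F.suc i))

  ∏ℕ-const : ∀ n k → ∏ℕ n (λ _ → k) ≡ k ℕ.^ n
  ∏ℕ-const zero    k = P.refl
  ∏ℕ-const (suc n) k = P.cong (k ℕ.*_) (∏ℕ-const n k)

  size-Π : ∀ {a r p : Level} (n : ℕ) {A : Fin n → Set a} {_~_ : ∀ i → A i → A i → Set r}
    {P : ∀ i → Pred (A i) p}
    (~-refl : ∀ i {x : A i} → _~_ i x x)
    (~-trans : ∀ i {x y z : A i} → _~_ i x y → _~_ i y z → _~_ i x z)
    (s : Fin n → ℕ) → (∀ i → HasSize (_~_ i) (P i) (s i)) →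
    HasSize (λ (f g : (i : Fin n) → A i) → ∀ i → _~_ i (f i) (g i))
            (λ (f : (i : Fin n) → A i) → ∀ i → P i (f i)) (∏ℕ n s)
  size-Π zero ~-refl ~-trans s h = record
    { elt = λ _ () ; elt-P = λ _ () ; elt-inj = λ { F.zero F.zero _ → P.refl }
    ; elt-surj = λ _ _ → F.zero , λ () }
  size-Π (suc n) {A} {_~_} {P} ~-refl ~-trans s h =
    map-size cons (λ e e′ i → ~-trans i (e i) (e′ i))
      (λ { _ (e₀ , e₊) → λ { F.zero → e₀ ; (F.suc i) → e₊ i } })
      (λ { (p₀ , p₊) → λ { F.zero → p₀ ; (F.suc i) → p₊ i } })
      (λ _ _ e → e F.zero , λ i → e (F.suc i))
      (λ {y} py → (y F.zero , λ i → y (F.suc i)) , (py F.zero , λ i → py (F.suc i)) ,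
         λ { F.zero → ~-refl F.zero ; (F.suc i) → ~-refl (F.suc i) })
      (size-× (h F.zero) (size-Π n {λ i → A (F.suc i)} {λ i → _~_ (F.suc i)} {λ i → P (F.suc i)}
                            (λ i → ~-refl (F.suc i)) (λ i → ~-trans (F.suc i)) (λ i → s (F.suc i)) (λ i → h (F.suc i))))
    where
    cons : A F.zero × ((i : Fin n) → A (F.suc i)) → (i : Fin (suc n)) → A i
    cons (x , g) F.zero    = x
    cons (x , g) (F.suc i) = g i

module IntegerIdentities where
  open import Data.Integer.Solver using (module +-*-Solver)
  open +-*-Solver
  open P.≡-Reasoning

  pos-^ : ∀ a n → + (a ℕ.^ n) ≡ (+ a) ℤ.^ n
  pos-^ a zero    = P.refl
  pos-^ a (suc n) = P.trans (ℤP.pos-* a (a ℕ.^ n)) (P.cong ((+ a) ℤ.*_) (pos-^ a n))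

  ^-distrib-* : ∀ a b n → (a ℤ.* b) ℤ.^ n ≡ a ℤ.^ n ℤ.* b ℤ.^ n
  ^-distrib-* a b zero    = P.refl
  ^-distrib-* a b (suc n) = P.trans (P.cong ((a ℤ.* b) ℤ.*_) (^-distrib-* a b n))
    (solve 4 (λ a b x y → (a :* b) :* (x :* y) := (a :* x) :* (b :* y)) P.refl a b (a ℤ.^ n) (b ℤ.^ n))

  closedForm : (S M Y : ℤ) (c : ℕ → ℤ) →
    c 1 ℤ.* (ℤ.1ℤ ℤ.+ S) ≡ S ℤ.- Y →
    (∀ j → c (suc (suc j)) ℤ.+ M ℤ.* c (suc j) ≡ (S ℤ.* M) ℤ.^ suc j) →
    ∀ j → c (suc j) ℤ.* (ℤ.1ℤ ℤ.+ S) ≡ M ℤ.^ j ℤ.* (S ℤ.^ suc j ℤ.+ (ℤ.- ℤ.1ℤ) ℤ.^ suc j ℤ.* Y)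
  closedForm S M Y c base step zero = P.trans base
    (solve 2 (λ S Y → S :- Y := con ℤ.1ℤ :* (S :* con ℤ.1ℤ :+ (con (ℤ.- ℤ.1ℤ) :* con ℤ.1ℤ) :* Y)) P.refl S Y)
  closedForm S M Y c base step (suc j) = begin
    c (suc (suc j)) ℤ.* (ℤ.1ℤ ℤ.+ S)
      ≡⟨ P.cong (ℤ._* (ℤ.1ℤ ℤ.+ S)) (P.trans (isolate (c (suc (suc j))) (M ℤ.* C)) (P.cong (ℤ._- M ℤ.* C) (step j))) ⟩
    ((S ℤ.* M) ℤ.^ suc j ℤ.- M ℤ.* C) ℤ.* (ℤ.1ℤ ℤ.+ S)
      ≡⟨ P.cong (λ x → (x ℤ.- M ℤ.* C) ℤ.* (ℤ.1ℤ ℤ.+ S)) (^-distrib-* S M (suc j)) ⟩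
    (Sʲ ℤ.* (M ℤ.* Mʲ) ℤ.- M ℤ.* C) ℤ.* (ℤ.1ℤ ℤ.+ S)
      ≡⟨ solve 5 (λ Sʲ M Mʲ C S → (Sʲ :* (M :* Mʲ) :- M :* C) :* (con ℤ.1ℤ :+ S)
                                  := Sʲ :* (M :* Mʲ) :* (con ℤ.1ℤ :+ S) :- M :* (C :* (con ℤ.1ℤ :+ S)))
               P.refl Sʲ M Mʲ C S ⟩
    Sʲ ℤ.* (M ℤ.* Mʲ) ℤ.* (ℤ.1ℤ ℤ.+ S) ℤ.- M ℤ.* (C ℤ.* (ℤ.1ℤ ℤ.+ S))
      ≡⟨ P.cong (λ x → Sʲ ℤ.* (M ℤ.* Mʲ) ℤ.* (ℤ.1ℤ ℤ.+ S) ℤ.- M ℤ.* x) (closedForm S M Y c base step j) ⟩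
    Sʲ ℤ.* (M ℤ.* Mʲ) ℤ.* (ℤ.1ℤ ℤ.+ S) ℤ.- M ℤ.* (Mʲ ℤ.* (Sʲ ℤ.+ Eʲ ℤ.* Y))
      ≡⟨ solve 6 (λ Sʲ M Mʲ S Eʲ Y → Sʲ :* (M :* Mʲ) :* (con ℤ.1ℤ :+ S) :- M :* (Mʲ :* (Sʲ :+ Eʲ :* Y))
                                     := (M :* Mʲ) :* (S :* Sʲ :+ (con (ℤ.- ℤ.1ℤ) :* Eʲ) :* Y))
               P.refl Sʲ M Mʲ S Eʲ Y ⟩
    M ℤ.^ suc j ℤ.* (S ℤ.^ suc (suc j) ℤ.+ (ℤ.- ℤ.1ℤ) ℤ.^ suc (suc j) ℤ.* Y) ∎
    where
    C  = c (suc j)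
    Sʲ = S ℤ.^ suc j
    Mʲ = M ℤ.^ j
    Eʲ = (ℤ.- ℤ.1ℤ) ℤ.^ suc j
    isolate : ∀ a b → a ≡ (a ℤ.+ b) ℤ.- b
    isolate = solve 2 (λ a b → a := (a :+ b) :- b) P.refl

  closedFormℕ : (s m : ℕ) (Y : ℤ) (c : ℕ → ℕ) →
    + c 1 ℤ.* + suc s ≡ + s ℤ.- Y →
    (∀ j → c (suc (suc j)) ℕ.+ m ℕ.* c (suc j) ≡ (s ℕ.* m) ℕ.^ suc j) →
    ∀ j → + c (suc j) ℤ.* + suc s ≡ + (m ℕ.^ j) ℤ.* ((+ s) ℤ.^ suc j ℤ.+ (ℤ.- ℤ.1ℤ) ℤ.^ suc j ℤ.* Y)
  closedFormℕ s m Y c base step j =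
    P.subst (λ x → + c (suc j) ℤ.* + suc s ≡ x ℤ.* _) (P.sym (pos-^ m j))
      (closedForm (+ s) (+ m) Y (λ i → + c i) base step-ℤ j)
    where
    step-ℤ : ∀ j → + c (suc (suc j)) ℤ.+ + m ℤ.* + c (suc j) ≡ (+ s ℤ.* + m) ℤ.^ suc j
    step-ℤ j = begin
      + c (suc (suc j)) ℤ.+ + m ℤ.* + c (suc j)
        ≡⟨ P.cong (λ x → + c (suc (suc j)) ℤ.+ x) (P.sym (ℤP.pos-* m (c (suc j)))) ⟩
      + (c (suc (suc j)) ℕ.+ m ℕ.* c (suc j)) ≡⟨ P.cong +_ (step j) ⟩
      + ((s ℕ.* m) ℕ.^ suc j)                ≡⟨ pos-^ (s ℕ.* m) (suc j) ⟩
      (+ (s ℕ.* m)) ℤ.^ suc j                ≡⟨ P.cong (ℤ._^ suc j) (ℤP.pos-* s m) ⟩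
      (+ s ℤ.* + m) ℤ.^ suc j                ∎

  ∏-pointwise : ∀ n (θ : Fin n → ℕ) (x y : Fin n → ℤ) → (∀ i → + θ i ℤ.* x i ≡ y i) →
    + Counting.∏ℕ n θ ℤ.* ∏ℤ n x ≡ ∏ℤ n y
  ∏-pointwise zero    θ x y θx≡y = P.refl
  ∏-pointwise (suc n) θ x y θx≡y = begin
    + (θ₀ ℕ.* Θ) ℤ.* (x F.zero ℤ.* X) ≡⟨ P.cong (ℤ._* (x F.zero ℤ.* X)) (ℤP.pos-* θ₀ Θ) ⟩
    (+ θ₀ ℤ.* + Θ) ℤ.* (x F.zero ℤ.* X)
      ≡⟨ solve 4 (λ a b c d → (a :* b) :* (c :* d) := (a :* c) :* (b :* d)) P.refl (+ θ₀) (+ Θ) (x F.zero) X ⟩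
    (+ θ₀ ℤ.* x F.zero) ℤ.* (+ Θ ℤ.* X)
      ≡⟨ P.cong₂ ℤ._*_ (θx≡y F.zero) (∏-pointwise n (tail θ) (tail x) (tail y) (λ i → θx≡y (F.suc i))) ⟩
    ∏ℤ (suc n) y ∎
    where
    θ₀ = θ F.zero
    Θ = Counting.∏ℕ n (tail θ)
    X = ∏ℤ n (tail x)

module Units {c ℓ} (R : CommutativeRing c ℓ) where
  open CommutativeRing R
  open IntegerCoefficientSolver R using (solve; _:*_; _:=_)

  unit-resp : ∀ {x y} → x ≈ y → IsUnit R x → IsUnit R y
  unit-resp x≈y (z , xz≈1) = z , trans (*-congʳ (sym x≈y)) xz≈1

  unit-* : ∀ {a b} → IsUnit R a → IsUnit R b → IsUnit R (a * b)
  unit-* {a} {b} (a′ , aa′≈1) (b′ , bb′≈1) = a′ * b′ ,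
    trans (solve 4 (λ a b a′ b′ → (a :* b) :* (a′ :* b′) := (a :* a′) :* (b :* b′)) refl a b a′ b′)
          (trans (*-cong aa′≈1 bb′≈1) (*-identityˡ 1#))

  exceptional-resp : ∀ {x y} → x ≈ y → IsExceptional R x → IsExceptional R y
  exceptional-resp x≈y (ux , u1-x) = unit-resp x≈y ux , unit-resp (+-congˡ (-‿cong x≈y)) u1-x

module Tuples {c ℓ} (R : CommutativeRing c ℓ) where
  open CommutativeRing R
  open Units R

  Tuple : ℕ → Set c
  Tuple j = Fin j → Carrier

  _≈ᵗ_ : ∀ {j} → Tuple j → Tuple j → Set ℓ
  x ≈ᵗ y = ∀ i → x i ≈ y i

  ≈ᵗ-refl : ∀ {j} {x : Tuple j} → x ≈ᵗ x
  ≈ᵗ-refl i = refl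

  ≈ᵗ-sym : ∀ {j} {x y : Tuple j} → x ≈ᵗ y → y ≈ᵗ x
  ≈ᵗ-sym x≈y i = sym (x≈y i)

  ≈ᵗ-trans : ∀ {j} {x y z : Tuple j} → x ≈ᵗ y → y ≈ᵗ z → x ≈ᵗ z
  ≈ᵗ-trans x≈y y≈z i = trans (x≈y i) (y≈z i)

  prod : ∀ j → Tuple j → Carrier
  prod = prodTuple R

  prod-cong : ∀ j {x y : Tuple j} → x ≈ᵗ y → prod j x ≈ prod j y
  prod-cong zero    x≈y = refl
  prod-cong (suc j) x≈y = *-cong (x≈y F.zero) (prod-cong j (λ i → x≈y (F.suc i)))

  Exceptional : ∀ j → Pred (Tuple j) (c ⊔ ℓ)
  Exceptional j x = ∀ i → IsExceptional R (x i)

  Exceptional-resp : ∀ {j} {x y : Tuple j} → x ≈ᵗ y → Exceptional j x → Exceptional j y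
  Exceptional-resp x≈y ex i = exceptional-resp (x≈y i) (ex i)

  prod-unit : ∀ j x → Exceptional j x → IsUnit R (prod j x)
  prod-unit zero    x ex = 1# , *-identityˡ 1#
  prod-unit (suc j) x ex = unit-* (proj₁ (ex F.zero)) (prod-unit j (tail x) (λ i → ex (F.suc i)))

  Solution : ∀ j → Carrier → Pred (Tuple j) (c ⊔ ℓ)
  Solution j v x = Exceptional j x × prod j x ≈ v

module FiniteLocalRing {c ℓ} (R : CommutativeRing c ℓ) (M : Pred (CommutativeRing.Carrier R) (c ⊔ ℓ))
                       (finite : Finite R) (local : IsUniqueMaximalIdeal R M) where
  open CommutativeRing R
  open IntegerCoefficientSolver R using (solve; _:+_; _:*_; _:-_; :-_; _:=_; con)
  open Units R
  open IsUniqueMaximalIdeal local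
  open IsMaximalIdeal isMaximal
  open IsIdeal isIdeal
  open import Algebra.Properties.Group +-group using (∙-cancelˡ)
  open import Relation.Binary.Reasoning.Setoid setoid

  one zero′ minusOne : ∀ {n} → IntegerCoefficientSolver.Polynomial R n
  one      = con (+ 1)
  zero′    = con (+ 0)
  minusOne = :- con (+ 1)

  -- The maximality clause quantifies over arbitrary predicates; applied to
  -- the ideal "M or X" it decides the proposition X.
  excludedMiddle : (X : Set (c ⊔ ℓ)) → Dec X
  excludedMiddle X with maximal (λ z → M z ⊎ X) M-or-X-isIdeal inj₁
    where
    M-or-X-isIdeal : IsIdeal R (λ z → M z ⊎ X)
    M-or-X-isIdeal = record
      { resp  = λ { e (inj₁ m) → inj₁ (resp e m) ; e (inj₂ x) → inj₂ x }
      ; zero∈ = inj₁ zero∈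
      ; +∈    = λ { (inj₁ a) (inj₁ b) → inj₁ (+∈ a b) ; (inj₂ x) _ → inj₂ x ; (inj₁ _) (inj₂ x) → inj₂ x }
      ; *∈    = λ { r (inj₁ a) → inj₁ (*∈ r a) ; r (inj₂ x) → inj₂ x } }
  ... | inj₁ ⊆M         = no (λ x → proper (⊆M (inj₂ x)))
  ... | inj₂ (inj₁ m1)  = ⊥-elim (proper m1)
  ... | inj₂ (inj₂ x)   = yes x

  M-multiple : ∀ {a z} r → M a → z ≈ r * a → M z
  M-multiple r ma z≈ra = resp (sym z≈ra) (*∈ r ma)

  M-combination : ∀ {a b z} r s → M a → M b → z ≈ r * a + s * b → M z
  M-combination r s ma mb z≈ = resp (sym z≈) (+∈ (*∈ r ma) (*∈ s mb))

  M-swap : ∀ {x y} → M (x - y) → M (y - x)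
  M-swap {x} {y} m = M-multiple (- 1#) m (solve 2 (λ x y → y :- x := minusOne :* (x :- y)) refl x y)

  unit⇒∉M : ∀ {x} → IsUnit R x → ¬ M x
  unit⇒∉M {x} (y , xy≈1) mx = proper (M-multiple y mx (trans (sym xy≈1) (*-comm x y)))

  adjoin : Pred Carrier (c ⊔ ℓ) → Carrier → Pred Carrier (c ⊔ ℓ)
  adjoin I y z = ∃ λ a → ∃ λ r → I a × z ≈ a + y * r

  adjoin-isIdeal : ∀ I y → IsIdeal R I → IsIdeal R (adjoin I y)
  adjoin-isIdeal I y I-ideal = record
    { resp  = λ { e (a , r , ia , z≈) → a , r , ia , trans (sym e) z≈ }
    ; zero∈ = 0# , 0# , I.zero∈ , solve 1 (λ y → zero′ := zero′ :+ y :* zero′) refl y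
    ; +∈    = λ { (a , r , ia , z≈) (a′ , r′ , ia′ , z′≈) → a + a′ , r + r′ , I.+∈ ia ia′ ,
        trans (+-cong z≈ z′≈)
              (solve 5 (λ a r a′ r′ y → (a :+ y :* r) :+ (a′ :+ y :* r′) := (a :+ a′) :+ y :* (r :+ r′))
                       refl a r a′ r′ y) }
    ; *∈    = λ { s (a , r , ia , z≈) → s * a , s * r , I.*∈ s ia ,
        trans (*-congˡ z≈) (solve 4 (λ s a r y → s :* (a :+ y :* r) := s :* a :+ y :* (s :* r)) refl s a r y) } }
    where module I = IsIdeal I-ideal

  ⊆adjoin : ∀ I y {z} → I z → adjoin I y z
  ⊆adjoin I y {z} iz = z , 0# , iz , solve 2 (λ z y → z := z :+ y :* zero′) refl z y

  ∈adjoin : ∀ I y → IsIdeal R I → adjoin I y y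
  ∈adjoin I y I-ideal = 0# , 1# , IsIdeal.zero∈ I-ideal , solve 1 (λ y → y := zero′ :+ y :* one) refl y

  size : ℕ
  size = proj₁ finite

  enum : Fin size → Carrier
  enum = HasSize.elt (proj₂ finite)

  enum-surj : ∀ x → ∃ λ i → enum i ≈ x
  enum-surj x = HasSize.elt-surj (proj₂ finite) x _

  countWhere : (n : ℕ) → (Fin n → Set (c ⊔ ℓ)) → ℕ
  countWhere zero    D = 0
  countWhere (suc n) D with excludedMiddle (D F.zero)
  ... | yes _ = suc (countWhere n (λ i → D (F.suc i)))
  ... | no _  = countWhere n (λ i → D (F.suc i))

  countWhere-≤ : ∀ n D → countWhere n D ℕ.≤ n
  countWhere-≤ zero    D = z≤n
  countWhere-≤ (suc n) D with excludedMiddle (D F.zero)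
  ... | yes _ = s≤s (countWhere-≤ n _)
  ... | no _  = ℕP.m≤n⇒m≤1+n (countWhere-≤ n _)

  countWhere-mono : ∀ n (D E : Fin n → Set (c ⊔ ℓ)) → (∀ i → D i → E i) → countWhere n D ℕ.≤ countWhere n E
  countWhere-mono zero    D E D⊆E = z≤n
  countWhere-mono (suc n) D E D⊆E with excludedMiddle (D F.zero) | excludedMiddle (E F.zero)
  ... | yes _ | yes _  = s≤s (countWhere-mono n _ _ (λ i → D⊆E (F.suc i)))
  ... | yes d | no ¬e  = ⊥-elim (¬e (D⊆E F.zero d))
  ... | no _  | yes _  = ℕP.m≤n⇒m≤1+n (countWhere-mono n _ _ (λ i → D⊆E (F.suc i)))
  ... | no _  | no _   = countWhere-mono n _ _ (λ i → D⊆E (F.suc i))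

  countWhere-strict : ∀ n (D E : Fin n → Set (c ⊔ ℓ)) → (∀ i → D i → E i) →
    ∀ i → E i → ¬ D i → countWhere n D < countWhere n E
  countWhere-strict (suc n) D E D⊆E F.zero eᵢ ¬dᵢ with excludedMiddle (D F.zero) | excludedMiddle (E F.zero)
  ... | yes d | _     = ⊥-elim (¬dᵢ d)
  ... | no _  | no ¬e = ⊥-elim (¬e eᵢ)
  ... | no _  | yes _ = s≤s (countWhere-mono n _ _ (λ i → D⊆E (F.suc i)))
  countWhere-strict (suc n) D E D⊆E (F.suc i) eᵢ ¬dᵢ with excludedMiddle (D F.zero) | excludedMiddle (E F.zero)
  ... | yes _ | yes _ = s≤s (countWhere-strict n _ _ (λ i → D⊆E (F.suc i)) i eᵢ ¬dᵢ)
  ... | yes d | no ¬e = ⊥-elim (¬e (D⊆E F.zero d))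
  ... | no _  | yes _ = ℕP.m≤n⇒m≤1+n (countWhere-strict n _ _ (λ i → D⊆E (F.suc i)) i eᵢ ¬dᵢ)
  ... | no _  | no _  = countWhere-strict n _ _ (λ i → D⊆E (F.suc i)) i eᵢ ¬dᵢ

  outside : Pred Carrier (c ⊔ ℓ) → ℕ
  outside I = countWhere size (λ i → ¬ I (enum i))

  outside-adjoin : ∀ I y → IsIdeal R I → ¬ I y → outside (adjoin I y) < outside I
  outside-adjoin I y I-ideal ¬iy =
    let (i , eᵢ≈y) = enum-surj y in
    countWhere-strict size _ _ (λ _ ∉J ∈I → ∉J (⊆adjoin I y ∈I)) i
      (λ ∈I → ¬iy (IsIdeal.resp I-ideal eᵢ≈y ∈I))
      (λ ∉J → ∉J (IsIdeal.resp (adjoin-isIdeal I y I-ideal) (sym eᵢ≈y) (∈adjoin I y I-ideal)))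

  saturated⇒maximal : ∀ I → IsIdeal R I → ¬ I 1# → ¬ (∃ λ y → ¬ I y × ¬ adjoin I y 1#) → IsMaximalIdeal R I
  saturated⇒maximal I I-ideal I-proper saturated =
    record { isIdeal = I-ideal ; proper = I-proper ; maximal = I-maximal }
    where
    I-maximal : ∀ J → IsIdeal R J → I ⊆ J → (J ⊆ I) ⊎ J 1#
    I-maximal J J-ideal I⊆J with excludedMiddle (∃ λ z → J z × ¬ I z)
    ... | no J⊆I = inj₁ (λ {w} jw → J⊆I′ w jw)
      where
      J⊆I′ : ∀ w → J w → I w
      J⊆I′ w jw with excludedMiddle (I w)
      ... | yes iw = iw
      ... | no ¬iw = ⊥-elim (J⊆I (w , jw , ¬iw))
    ... | yes (z , jz , ¬iz) with excludedMiddle (adjoin I z 1#)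
    ...   | no ¬1∈ = ⊥-elim (saturated (z , ¬iz , ¬1∈))
    ...   | yes (a , r , ia , 1≈a+zr) = inj₂ (IsIdeal.resp J-ideal (sym 1≈a+zr)
            (IsIdeal.+∈ J-ideal (I⊆J ia) (IsIdeal.resp J-ideal (*-comm r z) (IsIdeal.*∈ J-ideal r jz))))

  -- Every proper ideal lies in M: enlarge it one element at a time until it
  -- is maximal (at most 'size' steps), then use uniqueness of M.
  proper⊆M : (bound : ℕ) → ∀ I → IsIdeal R I → ¬ I 1# → outside I < bound → I ⊆ M
  proper⊆M (suc bound) I I-ideal I-proper outside<bound with excludedMiddle (∃ λ y → ¬ I y × ¬ adjoin I y 1#)
  ... | yes (y , ¬iy , J-proper) = λ iz →
        proper⊆M bound (adjoin I y) (adjoin-isIdeal I y I-ideal) J-proper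
          (ℕP.<-≤-trans (outside-adjoin I y I-ideal ¬iy) (ℕP.≤-pred outside<bound)) (⊆adjoin I y iz)
  ... | no saturated = proj₁ (unique I (saturated⇒maximal I I-ideal I-proper saturated))

  Zero : Pred Carrier (c ⊔ ℓ)
  Zero z = Lift (c ⊔ ℓ) (z ≈ 0#)

  Zero-isIdeal : IsIdeal R Zero
  Zero-isIdeal = record
    { resp  = λ e z → lift (trans (sym e) (lower z))
    ; zero∈ = lift refl
    ; +∈    = λ a b → lift (trans (+-cong (lower a) (lower b)) (+-identityˡ 0#))
    ; *∈    = λ r a → lift (trans (*-congˡ (lower a)) (zeroʳ r)) }

  -- In the local ring R the non-units are exactly the elements of M:
  -- if x is not a unit, the principal ideal xR = 0 + xR is proper.
  ∉M⇒unit : ∀ {x} → ¬ M x → IsUnit R x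
  ∉M⇒unit {x} ∉M with excludedMiddle (IsUnit R x)
  ... | yes u = u
  ... | no ¬u = ⊥-elim (∉M (proper⊆M (suc size) (adjoin Zero x) (adjoin-isIdeal Zero x Zero-isIdeal) xR-proper
                           (s≤s (countWhere-≤ size _)) (∈adjoin Zero x Zero-isIdeal)))
    where
    xR-proper : ¬ adjoin Zero x 1#
    xR-proper (a , r , lift a≈0 , 1≈a+xr) = ¬u (r , sym (trans 1≈a+xr (trans (+-congʳ a≈0) (+-identityˡ _))))

  -- A chosen inverse (0 for non-units).
  _⁻¹ : Carrier → Carrier
  x ⁻¹ with excludedMiddle (Lift (c ⊔ ℓ) (IsUnit R x))
  ... | yes (lift (y , _)) = y
  ... | no _               = 0#

  ⁻¹-inverseʳ : ∀ {x} → IsUnit R x → x * x ⁻¹ ≈ 1#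
  ⁻¹-inverseʳ {x} u with excludedMiddle (Lift (c ⊔ ℓ) (IsUnit R x))
  ... | yes (lift (y , xy≈1)) = xy≈1
  ... | no ¬u                 = ⊥-elim (¬u (lift u))

  ⁻¹-inverseˡ : ∀ {x} → IsUnit R x → x ⁻¹ * x ≈ 1#
  ⁻¹-inverseˡ u = trans (*-comm _ _) (⁻¹-inverseʳ u)

  ⁻¹-unit : ∀ {x} → IsUnit R x → IsUnit R (x ⁻¹)
  ⁻¹-unit {x} u = x , ⁻¹-inverseˡ u

  *⁻¹-cancel : ∀ {t} → IsUnit R t → ∀ b → (b * t) * t ⁻¹ ≈ b
  *⁻¹-cancel {t} u b = trans (*-assoc b t _) (trans (*-congˡ (⁻¹-inverseʳ u)) (*-identityʳ b))

  ⁻¹-cong : ∀ {a b} → IsUnit R a → a ≈ b → a ⁻¹ ≈ b ⁻¹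
  ⁻¹-cong {a} {b} ua a≈b = begin
    a ⁻¹              ≈⟨ sym (*-identityʳ _) ⟩
    a ⁻¹ * 1#         ≈⟨ *-congˡ (sym (⁻¹-inverseʳ ub)) ⟩
    a ⁻¹ * (b * b ⁻¹) ≈⟨ sym (*-assoc _ _ _) ⟩
    (a ⁻¹ * b) * b ⁻¹ ≈⟨ *-congʳ (trans (*-congˡ (sym a≈b)) (⁻¹-inverseˡ ua)) ⟩
    1# * b ⁻¹         ≈⟨ *-identityˡ _ ⟩
    b ⁻¹              ∎
    where ub = unit-resp a≈b ua

  *-cancelʳ : ∀ {a b c} → IsUnit R a → b * a ≈ c * a → b ≈ c
  *-cancelʳ {a} {b} {c} u ba≈ca = trans (sym (*⁻¹-cancel u b)) (trans (*-congʳ ba≈ca) (*⁻¹-cancel u c))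

  OneModM : Pred Carrier (c ⊔ ℓ)
  OneModM x = M (x - 1#)

  OneModM-resp : ∀ {x y} → x ≈ y → OneModM x → OneModM y
  OneModM-resp x≈y = resp (+-congʳ x≈y)

  exceptional⇒∉M : ∀ {x} → IsExceptional R x → ¬ M x
  exceptional⇒∉M (ux , _) = unit⇒∉M ux

  exceptional⇒∉1+M : ∀ {x} → IsExceptional R x → ¬ OneModM x
  exceptional⇒∉1+M (_ , u1-x) x∈1+M = unit⇒∉M u1-x (M-swap x∈1+M)

  exceptional-if : ∀ {x} → ¬ M x → ¬ OneModM x → IsExceptional R x
  exceptional-if ∉M ∉1+M = ∉M⇒unit ∉M , ∉M⇒unit (λ m → ∉1+M (M-swap m))

  1+M-unit : ∀ {μ} → M μ → IsUnit R (1# + μ)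
  1+M-unit {μ} mμ = ∉M⇒unit (λ m1+μ → proper (M-combination 1# (- 1#) m1+μ mμ
    (solve 1 (λ μ → one := one :* (one :+ μ) :+ minusOne :* μ) refl μ)))

  module Counts (m q : ℕ) (size-M : HasSize _≈_ M m)
                (size-R/M : HasSize (λ x y → _≡[mod_]_ R x M y) Every q) where
    open Counting
    open Tuples R
    open IntegerIdentities using (closedFormℕ)

    residue : Fin q → Carrier
    residue = HasSize.elt size-R/M

    Fin-size : HasSize _≡_ (Every {A = Fin q}) q
    Fin-size = record { elt = λ i → i ; elt-P = _ ; elt-inj = λ _ _ e → e ; elt-surj = λ i _ → i , P.refl }

    -- Every x ∈ R is uniquely residue i + μ with μ ∈ M, so |R| = q m.
    size-R : HasSize _≈_ Every (q ℕ.* m)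
    size-R = map-size (λ (i , μ) → residue i + μ) trans
      (λ { _ (P.refl , μ≈μ′) → +-congˡ μ≈μ′ }) (λ _ → lift tt) injective surjective (size-× Fin-size size-M)
      where
      injective : ∀ {x y : Fin q × Carrier} → Every (proj₁ x) × M (proj₂ x) → Every (proj₁ y) × M (proj₂ y) →
        residue (proj₁ x) + proj₂ x ≈ residue (proj₁ y) + proj₂ y → proj₁ x ≡ proj₁ y × proj₂ x ≈ proj₂ y
      injective {i , μ} {j , μ′} (_ , mμ) (_ , mμ′) e =
        let i≡j = HasSize.elt-inj size-R/M i j (M-combination 1# (- 1#) mμ′ mμ (begin
                    residue i - residue j
                      ≈⟨ solve 4 (λ a b u u′ → a :- b := ((a :+ u) :- (b :+ u′)) :+ (one :* u′ :+ minusOne :* u))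
                               refl (residue i) (residue j) μ μ′ ⟩
                    ((residue i + μ) - (residue j + μ′)) + (1# * μ′ + (- 1#) * μ)
                      ≈⟨ +-congʳ (trans (+-congʳ e) (-‿inverseʳ _)) ⟩
                    0# + (1# * μ′ + (- 1#) * μ) ≈⟨ +-identityˡ _ ⟩
                    1# * μ′ + (- 1#) * μ        ∎))
        in i≡j , ∙-cancelˡ (residue i) μ μ′ (P.subst (λ k → residue i + μ ≈ residue k + μ′) (P.sym i≡j) e)
      surjective : ∀ {y} → Every y → ∃ λ (x : Fin q × Carrier) → (Every (proj₁ x) × M (proj₂ x)) × residue (proj₁ x) + proj₂ x ≈ y
      surjective {y} _ = let (i , y≡rᵢ) = HasSize.elt-surj size-R/M y (lift tt) in
        (i , y - residue i) , (lift tt , M-swap y≡rᵢ) , solve 2 (λ a y → a :+ (y :- a) := y) refl (residue i) y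

    -- μ ↦ μ + 1 maps M onto 1 + M, so |1 + M| = m.
    size-1+M : HasSize _≈_ OneModM m
    size-1+M = map-size (λ μ → μ + 1#) trans (λ _ → +-congʳ)
      (λ {μ} mμ → resp (solve 1 (λ u → u := (u :+ one) :- one) refl μ) mμ)
      (λ {μ} {μ′} _ _ e → trans (solve 1 (λ u → u := (u :+ one) :- one) refl μ)
                            (trans (+-congʳ e) (solve 1 (λ u → (u :+ one) :- one := u) refl μ′)))
      (λ {y} my → y - 1# , my , solve 1 (λ y → (y :- one) :+ one := y) refl y) size-M

    size-exceptional-exists : ∃ λ T → HasSize _≈_ (IsExceptional R) T
    size-exceptional-exists =
      let (T , h) = size-restrict refl sym trans (λ _ _ → lift tt) exceptional-resp
                                  (λ x → excludedMiddle (IsExceptional R x)) size-R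
      in T , map-size (λ x → x) trans (λ _ e → e) proj₂ (λ _ _ e → e) (λ {y} ey → y , (lift tt , ey) , refl) h

    abstract
      T : ℕ
      T = proj₁ size-exceptional-exists

      size-exceptional : HasSize _≈_ (IsExceptional R) T
      size-exceptional = proj₂ size-exceptional-exists

    -- R is the disjoint union of M, 1 + M and the exceptional units.
    partition : m ℕ.+ (m ℕ.+ T) ≡ q ℕ.* m
    partition = size-unique sym trans
      (map-size (λ x → x) trans (λ _ e → e) (λ _ → lift tt) (λ _ _ e → e) cover size-M⊎1+M⊎E) size-R
      where
      M∩1+M-empty : ∀ {x} → M x → ¬ OneModM x
      M∩1+M-empty {x} mx x∈1+M = proper (M-combination 1# (- 1#) mx x∈1+M
        (solve 1 (λ x → one := one :* x :+ minusOne :* (x :- one)) refl x))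
      size-M⊎1+M⊎E = size-⊎ sym resp (λ { mx (inj₁ o) → M∩1+M-empty mx o ; mx (inj₂ ex) → exceptional⇒∉M ex mx })
        size-M (size-⊎ sym OneModM-resp (λ o ex → exceptional⇒∉1+M ex o) size-1+M size-exceptional)
      cover : ∀ {y} → Every y → ∃ λ x → (M x ⊎ (OneModM x ⊎ IsExceptional R x)) × x ≈ y
      cover {y} _ with excludedMiddle (M y) | excludedMiddle (OneModM y)
      ... | yes my | _      = y , inj₁ my , refl
      ... | no _   | yes o  = y , inj₂ (inj₁ o) , refl
      ... | no ∉M  | no ∉1+M = y , inj₂ (inj₂ (exceptional-if ∉M ∉1+M)) , refl

    T≡[q-2]m : 2 < q → T ≡ (q ∸ 2) ℕ.* m
    T≡[q-2]m (s≤s (s≤s (s≤s _))) = ℕP.+-cancelˡ-≡ m _ _ (ℕP.+-cancelˡ-≡ m _ _ partition)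

    size-exceptionalTuples : ∀ j → HasSize _≈ᵗ_ (Exceptional j) (T ℕ.^ j)
    size-exceptionalTuples j = P.subst (HasSize _≈ᵗ_ (Exceptional j)) (∏ℕ-const j T)
      (size-Π j (λ _ → refl) (λ _ → trans) (λ _ → T) (λ _ → size-exceptional))

    solutions-exist : ∀ j v → ∃ λ n → HasSize _≈ᵗ_ (Solution j v) n
    solutions-exist j v = size-restrict ≈ᵗ-refl ≈ᵗ-sym ≈ᵗ-trans Exceptional-resp
      (λ x≈y prod≈v → trans (sym (prod-cong j x≈y)) prod≈v)
      (λ x → decide (excludedMiddle (Lift (c ⊔ ℓ) (prod j x ≈ v)))) (size-exceptionalTuples j)
      where
      decide : ∀ {X : Set ℓ} → Dec (Lift (c ⊔ ℓ) X) → Dec X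
      decide (yes (lift x)) = yes x
      decide (no ¬x)        = no (λ x → ¬x (lift x))

    abstract
      solutions : ℕ → Carrier → ℕ
      solutions j v = proj₁ (solutions-exist j v)

      size-solutions : ∀ j v → HasSize _≈ᵗ_ (Solution j v) (solutions j v)
      size-solutions j v = proj₂ (solutions-exist j v)

    ProductCongruent : ∀ j → Carrier → Pred (Tuple j) (c ⊔ ℓ)
    ProductCongruent j v x = M (prod j x - v)

    prepend : ∀ {j} → Carrier → Tuple j → Tuple (suc j)
    prepend {j} v x = (v * prod j x ⁻¹) ∷ x

    -- Its new entry z is exceptional unless ∏x ≡ v mod M: z ≡ 1 would give
    -- ∏x ≡ z ∏x = v.
    prepend-solution : ∀ {j v x} → IsUnit R v → Exceptional j x → ¬ ProductCongruent j v x →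
      Solution (suc j) v (prepend v x)
    prepend-solution {j} {v} {x} uv ex ¬w≡v = exceptional-prepend , zw≈v
      where
      w = prod j x
      uw = prod-unit j x ex
      z = v * w ⁻¹
      zw≈v : z * w ≈ v
      zw≈v = trans (*-assoc v _ w) (trans (*-congˡ (⁻¹-inverseˡ uw)) (*-identityʳ v))
      exceptional-prepend : Exceptional (suc j) (prepend v x)
      exceptional-prepend F.zero = exceptional-if (unit⇒∉M (unit-* uv (⁻¹-unit uw)))
        (λ z∈1+M → ¬w≡v (M-multiple (- w) z∈1+M (begin
           w - v     ≈⟨ +-congˡ (-‿cong (sym zw≈v)) ⟩
           w - z * w ≈⟨ solve 2 (λ w z → w :- z :* w := (:- w) :* (z :- one)) refl w z ⟩
           (- w) * (z - 1#) ∎)))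
      exceptional-prepend (F.suc i) = ex i

    -- Every solution y of length j + 1 is prepend v (tail y), and its tail
    -- has product ≢ v mod M (otherwise y₀ ≡ 1).
    prepend-surjective : ∀ {j v y} → IsUnit R v → Solution (suc j) v y →
      (Exceptional j (tail y) × ¬ ProductCongruent j v (tail y)) × prepend v (tail y) ≈ᵗ y
    prepend-surjective {j} {v} {y} uv (ey , y₀w≈v) = (ex , ¬w≡v) , prepend≈y
      where
      ex = λ i → ey (F.suc i)
      w = prod j (tail y)
      y₀ = y F.zero
      ¬w≡v : ¬ ProductCongruent j v (tail y)
      ¬w≡v w≡v = exceptional⇒∉1+M (ey F.zero) (M-multiple (- (v ⁻¹ * y₀)) w≡v (sym (begin
        (- (v ⁻¹ * y₀)) * (w - v)
          ≈⟨ solve 4 (λ iv y₀ w v → (:- (iv :* y₀)) :* (w :- v) := (iv :* v) :* y₀ :- iv :* (y₀ :* w))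
                   refl (v ⁻¹) y₀ w v ⟩
        (v ⁻¹ * v) * y₀ - v ⁻¹ * (y₀ * w)
          ≈⟨ +-cong (*-congʳ (⁻¹-inverseˡ uv)) (-‿cong (trans (*-congˡ y₀w≈v) (⁻¹-inverseˡ uv))) ⟩
        1# * y₀ - 1# ≈⟨ +-congʳ (*-identityˡ y₀) ⟩
        y₀ - 1#      ∎)))
      prepend≈y : prepend v (tail y) ≈ᵗ y
      prepend≈y F.zero    = trans (*-congʳ (sym y₀w≈v)) (*⁻¹-cancel (prod-unit j (tail y) ex) y₀)
      prepend≈y (F.suc i) = refl

    prepend-size : ∀ j {v n} → IsUnit R v →
      HasSize _≈ᵗ_ (λ x → Exceptional j x × ¬ ProductCongruent j v x) n → HasSize _≈ᵗ_ (Solution (suc j) v) n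
    prepend-size j {v} uv = map-size (prepend v) ≈ᵗ-trans prepend-cong
      (λ (ex , ¬w≡v) → prepend-solution uv ex ¬w≡v) (λ _ _ e i → e (F.suc i))
      (λ {y} sol → tail y , prepend-surjective uv sol)
      where
      prepend-cong : ∀ {x y} → Exceptional j x × ¬ ProductCongruent j v x → x ≈ᵗ y → prepend v x ≈ᵗ prepend v y
      prepend-cong {x} (ex , _) x≈y F.zero    = *-congˡ (⁻¹-cong (prod-unit j x ex) (prod-cong j x≈y))
      prepend-cong         _    x≈y (F.suc i) = x≈y i

    rescale : ∀ {j} → Carrier × Tuple (suc j) → Tuple (suc j)
    rescale (μ , x) = ((1# + μ) * x F.zero) ∷ tail x

    rescale-valid : ∀ {j v μ x} → M μ → Solution (suc j) v x →
      Exceptional (suc j) (rescale (μ , x)) × ProductCongruent (suc j) v (rescale (μ , x))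
    rescale-valid {j} {v} {μ} {x} mμ (ex , x₀t≈v) = exceptional-rescale , congruent
      where
      x₀ = x F.zero
      t = prod j (tail x)
      exceptional-rescale : Exceptional (suc j) (rescale (μ , x))
      exceptional-rescale F.zero = exceptional-if (unit⇒∉M (unit-* (1+M-unit mμ) (proj₁ (ex F.zero))))
        (λ ≡1 → exceptional⇒∉1+M (ex F.zero) (M-combination 1# (- x₀) ≡1 mμ
           (solve 2 (λ μ x₀ → x₀ :- one := one :* ((one :+ μ) :* x₀ :- one) :+ (:- x₀) :* μ) refl μ x₀)))
      exceptional-rescale (F.suc i) = ex (F.suc i)
      congruent : M (((1# + μ) * x₀) * t - v)
      congruent = M-combination 1# (x₀ * t) (resp (sym (trans (+-congʳ x₀t≈v) (-‿inverseʳ v))) zero∈) mμ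
        (solve 4 (λ μ x₀ t v → ((one :+ μ) :* x₀) :* t :- v := one :* (x₀ :* t :- v) :+ (x₀ :* t) :* μ)
                 refl μ x₀ t v)

    -- On solutions, rescaling is injective: the tails agree, so the first
    -- entries agree (cancel t), and then 1 + μ = 1 + μ′ (cancel x₀).
    rescale-injective : ∀ {j v μ μ′ x x′} → Solution (suc j) v x → Solution (suc j) v x′ →
      rescale (μ , x) ≈ᵗ rescale (μ′ , x′) → μ ≈ μ′ × x ≈ᵗ x′
    rescale-injective {j} {v} {μ} {μ′} {x} {x′} (ex , x₀t≈v) (_ , x₀′t′≈v) e = μ≈μ′ , x≈x′
      where
      t≈t′ = prod-cong j (λ i → e (F.suc i))
      x₀≈x₀′ : x F.zero ≈ x′ F.zero
      x₀≈x₀′ = *-cancelʳ (prod-unit j (tail x) (λ i → ex (F.suc i)))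
                 (trans x₀t≈v (trans (sym x₀′t′≈v) (*-congˡ (sym t≈t′))))
      μ≈μ′ : μ ≈ μ′
      μ≈μ′ = ∙-cancelˡ 1# μ μ′ (*-cancelʳ (proj₁ (ex F.zero)) (trans (e F.zero) (*-congˡ (sym x₀≈x₀′))))
      x≈x′ : x ≈ᵗ x′
      x≈x′ F.zero    = x₀≈x₀′
      x≈x′ (F.suc i) = e (F.suc i)

    -- An exceptional tuple y with ∏y ≡ v mod M is the rescaling of the
    -- solution x = (v t⁻¹) ∷ tail y by μ = ∏y v⁻¹ - 1 ∈ M  (t = ∏ tail y).
    rescale-surjective : ∀ {j v y} → IsUnit R v → Exceptional (suc j) y → ProductCongruent (suc j) v y →
      ∃ λ μx → (M (proj₁ μx) × Solution (suc j) v (proj₂ μx)) × rescale μx ≈ᵗ y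
    rescale-surjective {j} {v} {y} uv ey y≡v = (μ , x) , (mμ , (ex , xprod≈v)) , rescale≈y
      where
      y₀ = y F.zero
      t = prod j (tail y)
      ut = prod-unit j (tail y) (λ i → ey (F.suc i))
      μ = (y₀ * t) * v ⁻¹ - 1#
      x = (v * t ⁻¹) ∷ tail y
      mμ : M μ
      mμ = M-multiple (v ⁻¹) y≡v (sym (begin
        v ⁻¹ * (y₀ * t - v)          ≈⟨ solve 3 (λ iv w v → iv :* (w :- v) := w :* iv :- iv :* v) refl (v ⁻¹) (y₀ * t) v ⟩
        (y₀ * t) * v ⁻¹ - v ⁻¹ * v   ≈⟨ +-congˡ (-‿cong (⁻¹-inverseˡ uv)) ⟩
        μ                            ∎))
      ex : Exceptional (suc j) x
      ex F.zero = exceptional-if (unit⇒∉M (unit-* uv (⁻¹-unit ut)))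
        (λ ≡1 → exceptional⇒∉1+M (ey F.zero) (M-combination 1# (t ⁻¹) ≡1 y≡v (sym (begin
           1# * (v * t ⁻¹ - 1#) + t ⁻¹ * (y₀ * t - v)
             ≈⟨ solve 4 (λ v it y₀ t → one :* (v :* it :- one) :+ it :* (y₀ :* t :- v) := (it :* t) :* y₀ :- one)
                      refl v (t ⁻¹) y₀ t ⟩
           (t ⁻¹ * t) * y₀ - 1# ≈⟨ +-congʳ (trans (*-congʳ (⁻¹-inverseˡ ut)) (*-identityˡ y₀)) ⟩
           y₀ - 1#              ∎))))
      ex (F.suc i) = ey (F.suc i)
      xprod≈v : prod (suc j) x ≈ v
      xprod≈v = trans (*-assoc v (t ⁻¹) t) (trans (*-congˡ (⁻¹-inverseˡ ut)) (*-identityʳ v))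
      rescale≈y : rescale (μ , x) ≈ᵗ y
      rescale≈y F.zero = begin
        (1# + μ) * (v * t ⁻¹)
          ≈⟨ solve 5 (λ y₀ t iv v it → (one :+ ((y₀ :* t) :* iv :- one)) :* (v :* it) := y₀ :* ((t :* it) :* (iv :* v)))
                   refl y₀ t (v ⁻¹) v (t ⁻¹) ⟩
        y₀ * ((t * t ⁻¹) * (v ⁻¹ * v)) ≈⟨ *-congˡ (*-cong (⁻¹-inverseʳ ut) (⁻¹-inverseˡ uv)) ⟩
        y₀ * (1# * 1#)                 ≈⟨ *-congˡ (*-identityˡ 1#) ⟩
        y₀ * 1#                        ≈⟨ *-identityʳ y₀ ⟩
        y₀                             ∎
      rescale≈y (F.suc i) = refl

    rescale-size : ∀ j {v n} → IsUnit R v → HasSize _≈ᵗ_ (Solution (suc j) v) n →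
      HasSize _≈ᵗ_ (λ x → Exceptional (suc j) x × ProductCongruent (suc j) v x) (m ℕ.* n)
    rescale-size j uv h = map-size rescale ≈ᵗ-trans rescale-cong
      (λ (mμ , sol) → rescale-valid mμ sol) (λ (_ , sol) (_ , sol′) → rescale-injective sol sol′)
      (λ (ey , y≡v) → rescale-surjective uv ey y≡v) (size-× size-M h)
      where
      rescale-cong : ∀ {a b} → _ → proj₁ a ≈ proj₁ b × proj₂ a ≈ᵗ proj₂ b → rescale a ≈ᵗ rescale b
      rescale-cong _ (μ≈μ′ , x≈x′) F.zero    = *-cong (+-congˡ μ≈μ′) (x≈x′ F.zero)
      rescale-cong _ (μ≈μ′ , x≈x′) (F.suc i) = x≈x′ (F.suc i)

    -- Splitting the T^(j+1) exceptional (j+1)-tuples by whether their product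
    -- is ≡ v mod M:  c_{j+2}(v) + m c_{j+1}(v) = T^(j+1).
    recurrence : ∀ j {v} → IsUnit R v → solutions (suc (suc j)) v ℕ.+ m ℕ.* solutions (suc j) v ≡ T ℕ.^ suc j
    recurrence j {v} uv =
      let (n₁ , n₂ , h₁ , h₂ , n₁+n₂≡) = size-split ≈ᵗ-refl ≈ᵗ-sym ≈ᵗ-trans Exceptional-resp
            (λ x≈y → resp (+-congʳ (prod-cong (suc j) x≈y))) (λ x → excludedMiddle (ProductCongruent (suc j) v x))
            (size-exceptionalTuples (suc j))
          c₂≡n₂ = size-unique ≈ᵗ-sym ≈ᵗ-trans (size-solutions (suc (suc j)) v) (prepend-size (suc j) uv h₂)
          mc₁≡n₁ = size-unique ≈ᵗ-sym ≈ᵗ-trans (rescale-size j uv (size-solutions (suc j) v)) h₁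
      in P.trans (P.cong₂ ℕ._+_ c₂≡n₂ mc₁≡n₁) (P.trans (ℕP.+-comm n₂ n₁) n₁+n₂≡)

    -- c₁(v) = 0 for v ∈ 1 + M, since a one-tuple (v) is exceptional iff v ∉ 1 + M.
    solutions-1-∈1+M : ∀ {v} → OneModM v → solutions 1 v ≡ 0
    solutions-1-∈1+M {v} v≡1 = size-unique ≈ᵗ-sym ≈ᵗ-trans (size-solutions 1 v) none
      where
      none : HasSize _≈ᵗ_ (Solution 1 v) 0
      none = record { elt = λ () ; elt-P = λ () ; elt-inj = λ ()
        ; elt-surj = λ x (ex , x₀1≈v) → ⊥-elim (exceptional⇒∉1+M (ex F.zero)
            (OneModM-resp (sym (trans (sym (*-identityʳ _)) x₀1≈v)) v≡1)) }

    solutions-1-∉1+M : ∀ {v} → IsUnit R v → ¬ OneModM v → solutions 1 v ≡ 1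
    solutions-1-∉1+M {v} uv v≢1 = size-unique ≈ᵗ-sym ≈ᵗ-trans (size-solutions 1 v) just-v
      where
      just-v : HasSize _≈ᵗ_ (Solution 1 v) 1
      just-v = record
        { elt      = λ _ _ → v
        ; elt-P    = λ _ → (λ _ → exceptional-if (unit⇒∉M uv) v≢1) , *-identityʳ v
        ; elt-inj  = λ { F.zero F.zero _ → P.refl }
        ; elt-surj = λ x (_ , x₀1≈v) → F.zero , λ { F.zero → sym (trans (sym (*-identityʳ _)) x₀1≈v) } }

    solutions-closedForm : 2 < q → ∀ {v} → IsUnit R v → (Y : ℤ) →
      + solutions 1 v ℤ.* + (q ∸ 1) ≡ + (q ∸ 2) ℤ.- Y →
      ∀ j → + solutions (suc j) v ℤ.* + (q ∸ 1) ≡ + (m ℕ.^ j) ℤ.* ((+ (q ∸ 2)) ℤ.^ suc j ℤ.+ (ℤ.- ℤ.1ℤ) ℤ.^ suc j ℤ.* Y)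
    solutions-closedForm 2<q@(s≤s (s≤s (s≤s _))) {v} uv Y base =
      closedFormℕ (q ∸ 2) m Y (λ i → solutions i v) base
        (λ i → P.trans (recurrence i uv) (P.cong (ℕ._^ suc i) (T≡[q-2]m 2<q)))

    localFormula : 2 < q → (k : ℕ) → 1 ≤ k → (v : Carrier) → IsUnit R v → (σ : ℤ) →
      SigmaSpec q k (OneModM v) σ → + solutions k v ℤ.* + (q ∸ 1) ≡ + (m ℕ.^ (k ∸ 1)) ℤ.* σ
    localFormula 2<q@(s≤s (s≤s (s≤s _))) (suc j) _ v uv σ (σ-∈1+M , σ-∉1+M)
      with excludedMiddle (OneModM v)
    ... | yes v≡1 = P.trans (solutions-closedForm 2<q uv (+ s) c₁≡0 j)
                            (P.cong (+ (m ℕ.^ j) ℤ.*_) (P.sym (σ-∈1+M v≡1)))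
      where
      s = q ∸ 2
      c₁≡0 : + solutions 1 v ℤ.* + suc s ≡ + s ℤ.- + s
      c₁≡0 = P.trans (P.cong (λ n → + n ℤ.* + suc s) (solutions-1-∈1+M v≡1)) (P.sym (ℤP.+-inverseʳ (+ s)))
    ... | no v≢1 = P.trans (solutions-closedForm 2<q uv (ℤ.- ℤ.1ℤ) c₁≡1 j)
                           (P.cong (+ (m ℕ.^ j) ℤ.*_) (P.trans (P.cong (λ e → (+ s) ℤ.^ suc j ℤ.+ e) (ℤP.*-comm _ (ℤ.- ℤ.1ℤ)))
                                                               (P.sym (σ-∉1+M v≢1))))
      where
      s = q ∸ 2
      c₁≡1 : + solutions 1 v ℤ.* + suc s ≡ + s ℤ.- (ℤ.- ℤ.1ℤ)
      c₁≡1 = P.trans (P.cong (λ n → + n ℤ.* + suc s) (solutions-1-∉1+M uv v≢1))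
                (P.trans (ℤP.*-identityˡ (+ suc s)) (P.cong +_ (ℕP.+-comm 1 s)))

module DirectSum {c ℓ} (n : ℕ) (R : Fin n → CommutativeRing c ℓ) where
  open Counting
  private
    ⨁R = ⨁ n R
    module ⨁R = CommutativeRing ⨁R
    module Rᵢ i = CommutativeRing (R i)
    module Tᵢ i = Tuples (R i)

  prodTuple-⨁ : ∀ k (x : Fin k → ⨁R.Carrier) i → prodTuple ⨁R k x i ≡ prodTuple (R i) k (λ j → x j i)
  prodTuple-⨁ zero    x i = P.refl
  prodTuple-⨁ (suc k) x i = P.cong (Rᵢ._*_ i (x F.zero i)) (prodTuple-⨁ k (tail x) i)

  exceptional-components : ∀ {x} → IsExceptional ⨁R x → ∀ i → IsExceptional (R i) (x i)
  exceptional-components ((y , xy≈1) , (y′ , [1-x]y′≈1)) i = (y i , xy≈1 i) , (y′ i , [1-x]y′≈1 i)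

  exceptional-from-components : ∀ {x} → (∀ i → IsExceptional (R i) (x i)) → IsExceptional ⨁R x
  exceptional-from-components ex =
    ((λ i → proj₁ (proj₁ (ex i))) , λ i → proj₂ (proj₁ (ex i))) ,
    ((λ i → proj₁ (proj₂ (ex i))) , λ i → proj₂ (proj₂ (ex i)))

  size-solutions-⨁ : ∀ k u (θ : Fin n → ℕ) →
    (∀ i → HasSize (Tᵢ._≈ᵗ_ i) (Tᵢ.Solution i k (u i)) (θ i)) →
    HasSize (λ s t → ∀ j → ⨁R._≈_ (s j) (t j))
      (λ (x : Fin k → ⨁R.Carrier) → (∀ j → IsExceptional ⨁R (x j)) × ⨁R._≈_ (prodTuple ⨁R k x) u)
      (∏ℕ n θ)
  size-solutions-⨁ k u θ h = map-size transpose (λ e e′ j i → Rᵢ.trans i (e j i) (e′ j i))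
    (λ _ e j i → e i j) solution-⨁ (λ _ _ e i j → e j i)
    (λ {y} sol → (λ i j → y j i) , solution-components sol , λ j i → Rᵢ.refl i)
    (size-Π n (λ i j → Rᵢ.refl i) (λ i → Tᵢ.≈ᵗ-trans i) θ h)
    where
    transpose : ((i : Fin n) → Fin k → Rᵢ.Carrier i) → Fin k → ⨁R.Carrier
    transpose x j i = x i j
    solution-⨁ : ∀ {x} → (∀ i → Tᵢ.Solution i k (u i) (x i)) →
      (∀ j → IsExceptional ⨁R (transpose x j)) × ⨁R._≈_ (prodTuple ⨁R k (transpose x)) u
    solution-⨁ sol = (λ j → exceptional-from-components (λ i → proj₁ (sol i) j))
      , λ i → P.subst (λ z → Rᵢ._≈_ i z (u i)) (P.sym (prodTuple-⨁ k (transpose _) i)) (proj₂ (sol i))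
    solution-components : ∀ {y} → (∀ j → IsExceptional ⨁R (y j)) × ⨁R._≈_ (prodTuple ⨁R k y) u →
      ∀ i → Tᵢ.Solution i k (u i) (λ j → y j i)
    solution-components (ex , prod≈u) i = (λ j → exceptional-components (ex j) i)
      , P.subst (λ z → Rᵢ._≈_ i z (u i)) (prodTuple-⨁ k _ i) (prod≈u i)

theorem1p8 : ∀ {c ℓ : Level} (n : ℕ) (R : Fin n → CommutativeRing c ℓ)
    (M : (i : Fin n) → CommutativeRing.Carrier (R i) → Set (Level._⊔_ c ℓ))
    (m q : Fin n → ℕ) →
    (∀ i → Finite (R i)) →
    (∀ i → IsUniqueMaximalIdeal (R i) (M i)) →
    (∀ i → HasSize (CommutativeRing._≈_ (R i)) (M i) (m i)) →
    (∀ i → HasSize (λ x y → _≡[mod_]_ (R i) x (M i) y) Every (q i)) →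
    (∀ i → 2 < q i) →
    (k : ℕ) → 2 ≤ k →
    (u : CommutativeRing.Carrier (⨁ n R)) → IsUnit (⨁ n R) u →
    (σ : Fin n → ℤ) →
    (∀ i → SigmaSpec (q i) k (_≡[mod_]_ (R i) (u i) (M i) (CommutativeRing.1# (R i))) (σ i)) →
    ∃ λ (θ : ℕ) →
    HasSize (λ s t → ∀ j → CommutativeRing._≈_ (⨁ n R) (s j) (t j))
    (λ (x : Fin k → CommutativeRing.Carrier (⨁ n R)) →
    (∀ j → IsExceptional (⨁ n R) (x j))
    × CommutativeRing._≈_ (⨁ n R) (prodTuple (⨁ n R) k x) u)
    θ
    × ℤ.+ θ ℤ.* ∏ℤ n (λ i → ℤ.+ (q i ∸ 1))
    ≡ ∏ℤ n (λ i → ℤ.+ (m i ℕ.^ (k ∸ 1)) ℤ.* σ i)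
theorem1p8 n R M m q finite local size-M size-R/M 2<q k 2≤k u (u⁻¹ , uu⁻¹≈1) σ σ-spec =
  Counting.∏ℕ n θ , DirectSum.size-solutions-⨁ n R k u θ (λ i → Local.size-solutions i k (u i)) ,
  IntegerIdentities.∏-pointwise n θ _ _ local-formula
  where
  module Local i = FiniteLocalRing.Counts (R i) (M i) (finite i) (local i) (m i) (q i) (size-M i) (size-R/M i)

  θ : Fin n → ℕ
  θ i = Local.solutions i k (u i)

  local-formula : ∀ i → + θ i ℤ.* + (q i ∸ 1) ≡ + (m i ℕ.^ (k ∸ 1)) ℤ.* σ i
  local-formula i = Local.localFormula i (2<q i) k (ℕP.≤-trans (s≤s z≤n) 2≤k) (u i) (u⁻¹ i , uu⁻¹≈1 i) (σ i) (σ-spec i)
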